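{- Let $n\ge 4$ and let $G$ be an optimal digraph on $n$ vertices with $\beta_G > \alpha_G$. For every augmenting sequence $v_1, f_1, v_2, f_2, \dots, f_k, v_{k+1}$ in $G$, we have $v_i \neq v_j$ for all $i \neq j$, except possibly $v_{k+1} = v_1$.
   Context: Digraphs are finite and simple (no loops, no multiple edges); $2$-free means no distinct $u,v$ with both $uv,vu\in E(G)$. A circular interval digraph is a digraph whose vertices are arranged in a (fixed) circle such that for all distinct $u,v,w$ in clockwise order, $uw\in E(G)$ implies $uv,vw\in E(G)$. For distinct vertices $u,v$ let $d(u,v)=1+|\{w: u,w,v \text{ distinct, in clockwise order}\}|$; this is the length of the ordered pair $uv$. A non-edge is an ordered pair $uv$ of distinct vertices with $uv\notin E(G)$ and $vu\notin E(G)$; its length is $d(u,v)$. $\alpha_G$ is the least length of a non-edge ($\infty$ if there is none) and $\beta_G$ the greatest length of an edge ($0$ if there is none). A longest edge is an edge of length $\beta_G$; a shortest non-edge is a non-edge of length $\alpha_G$; an extreme pair is a longest edge or a shortest non-edge. An alternating sequence is a sequence $v_1,f_1,v_2,f_2,\dots,f_k,v_{k+1}$ where the $v_i$ are vertices, each $f_i=v_iv_{i+1}$ is an extreme pair, $f_i\neq f_j$ for $i\ne j$, and for $1\le i\le k-1$, if $f_i$ is an edge then $f_{i+1}$ is a non-edge, and if $f_i$ is a non-edge then $f_{i+1}$ is an edge. An augmenting sequence is a maximal alternating sequence. $\tilde{P}_3(G)$ is the number of ordered triples $(u,w,v)$ of distinct vertices with $uw,wv\in E(G)$ and neither $uv$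 nor $vu$ in $E(G)$. $\xi(G)$ is the number of pairs $(uv,wx)$ where $uv\in E(G)$, $wx$ is a non-edge and $d(u,v)>d(w,x)$. For fixed $n\ge 4$, a digraph $G$ is optimal if it is a $2$-free circular interval digraph on $n$ vertices which, among all $2$-free circular interval digraphs on $n$ vertices, maximizes $\tilde{P}_3$, and subject to this minimizes $\xi$. -}

module Defs where

open import Data.Nat using (ℕ; zero; suc; _+_; _∸_; _≤_; _<_; _⊔_; _⊓_; _<ᵇ_)
open import Data.Bool using (Bool; true; false; if_then_else_; _∧_; not)
open import Data.Fin using (Fin; toℕ; inject₁; _≟_)
  renaming (suc to fsuc)
open import Data.List using (List; allFin; map; foldr)
open import Data.Nat.ListAction using (sum)
open import Data.Maybe using (Maybe; just; nothing)
open import Data.Vec using (Vec; lookup; _∷ʳ_)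
open import Data.Product using (_×_; Σ)
open import Data.Sum using (_⊎_)
open import Relation.Nullary using (¬_)
open import Relation.Nullary.Decidable using (⌊_⌋)
open import Relation.Binary.PropositionalEquality using (_≡_; _≢_)

-- Vertices are Fin n, arranged on the circle clockwise in index order
-- 0, 1, ..., n-1 (then back to 0).  A digraph is given by a Boolean
-- adjacency relation.
Digraph : ℕ → Set
Digraph n = Fin n → Fin n → Bool

module _ {n : ℕ} where

  Clockwise : Fin n → Fin n → Fin n → Set
  Clockwise u v w =
      (toℕ u < toℕ v × toℕ v < toℕ w)
    ⊎ (toℕ v < toℕ w × toℕ w < toℕ u)
    ⊎ (toℕ w < toℕ u × toℕ u < toℕ v)

  -- length d(u,v) = 1 + #{w : u,w,v distinct in clockwise order}
  -- (only meaningful for u ≠ v)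
  dist : Fin n → Fin n → ℕ
  dist u v = if toℕ u <ᵇ toℕ v then toℕ v ∸ toℕ u else n ∸ (toℕ u ∸ toℕ v)

  Loopless : Digraph n → Set
  Loopless G = ∀ u → G u u ≡ false

  TwoFree : Digraph n → Set
  TwoFree G = ∀ u v → G u v ≡ true → G v u ≡ false

  CircularInterval : Digraph n → Set
  CircularInterval G = ∀ u v w → Clockwise u v w → G u w ≡ true →
                       (G u v ≡ true × G v w ≡ true)

  Admissible : Digraph n → Set
  Admissible G = Loopless G × TwoFree G × CircularInterval G

  distinct? : Fin n → Fin n → Bool
  distinct? u v = not ⌊ u ≟ v ⌋

  nonEdge? : Digraph n → Fin n → Fin n → Bool
  nonEdge? G u v = distinct? u v ∧ not (G u v) ∧ not (G v u)

  ind : Bool → ℕ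
  ind b = if b then 1 else 0

  ΣFin : (Fin n → ℕ) → ℕ
  ΣFin f = sum (map f (allFin n))

  P3 : Digraph n → ℕ
  P3 G = ΣFin λ u → ΣFin λ w → ΣFin λ v →
    ind (distinct? u w ∧ distinct? w v ∧ distinct? u v ∧
         G u w ∧ G w v ∧ not (G u v) ∧ not (G v u))

  ξ : Digraph n → ℕ
  ξ G = ΣFin λ u → ΣFin λ v → ΣFin λ w → ΣFin λ x →
    ind (G u v ∧ nonEdge? G w x ∧ (dist w x <ᵇ dist u v))

  Optimal : Digraph n → Set
  Optimal G = Admissible G
            × (∀ H → Admissible H → P3 H ≤ P3 G)
            × (∀ H → Admissible H → P3 H ≡ P3 G → ξ G ≤ ξ H)

  β : Digraph n → ℕ
  β G = foldr _⊔_ 0 (map (λ u → foldr _⊔_ 0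
          (map (λ v → if G u v then dist u v else 0) (allFin n))) (allFin n))

  minM : Maybe ℕ → Maybe ℕ → Maybe ℕ
  minM nothing y = y
  minM (just x) nothing = just x
  minM (just x) (just y) = just (x ⊓ y)

  -- α_G: least length of a non-edge (nothing = ∞ if there is none)
  α : Digraph n → Maybe ℕ
  α G = foldr minM nothing (map (λ u → foldr minM nothing
          (map (λ v → if nonEdge? G u v then just (dist u v) else nothing)
               (allFin n))) (allFin n))

  -- β_G > α_G  (false when α_G = ∞)
  BetaGtAlpha : Digraph n → Set
  BetaGtAlpha G = Σ ℕ λ a → α G ≡ just a × a < β G

  LongestEdge : Digraph n → Fin n → Fin n → Set
  LongestEdge G u v = G u v ≡ true × dist u v ≡ β G

  ShortestNonEdge : Digraph n → Fin n → Fin n → Set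
  ShortestNonEdge G u v = nonEdge? G u v ≡ true × α G ≡ just (dist u v)

  Extreme : Digraph n → Fin n → Fin n → Set
  Extreme G u v = LongestEdge G u v ⊎ ShortestNonEdge G u v

  -- alternating sequence v₁ f₁ v₂ … f_k v_{k+1}, given by its vertices
  -- vs = (v₁,…,v_{k+1}); f_i = v_i v_{i+1} (i : Fin k, 0-based)
  module _ (G : Digraph n) {k : ℕ} (vs : Vec (Fin n) (suc k)) where
    src tgt : Fin k → Fin n
    src i = lookup vs (inject₁ i)
    tgt i = lookup vs (fsuc i)

    Alternating : Set
    Alternating =
        (∀ i → Extreme G (src i) (tgt i))
      × (∀ i j → i ≢ j → ¬ (src i ≡ src j × tgt i ≡ tgt j))
      × (∀ i j → toℕ j ≡ suc (toℕ i) →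
           (G (src i) (tgt i) ≡ true → nonEdge? G (src j) (tgt j) ≡ true)
         × (nonEdge? G (src i) (tgt i) ≡ true → G (src j) (tgt j) ≡ true))

  -- maximal: alternating and cannot be extended by a further f_{k+1}, v_{k+2}
  Augmenting : Digraph n → {k : ℕ} → Vec (Fin n) (suc k) → Set
  Augmenting G vs = Alternating G vs × (∀ w → ¬ Alternating G (vs ∷ʳ w))

module Submission where

-- Let G be a 2-free circular interval digraph with β_G > α_G.
-- Every longest edge is then strictly longer than every shortest non-edge,
-- which forces each vertex to be the tail of at most one extreme pair and
-- the head of at most one:
--
--   * two longest edges (or two shortest non-edges) with a common tail have
--     the same length, hence the same head; symmetrically for a common head;
--   * a longest edge uv and a shortest non-edge uw cannot share the tail u:
--     uw is the shorter arc, so w lies strictly inside the arc from u to v,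
--     and the interval property would make uw an edge; symmetrically for
--     a common head.
--
-- The pairs f_1, …, f_k of an alternating sequence are distinct, so by
-- uniqueness of heads v_{j+1} (j ≥ 1) is entered only by f_j, and by
-- uniqueness of tails v_1 can only recur at a position that is not the tail
-- of any f_j, i.e. at v_{k+1}.

open import Defs
open import Data.Nat using (ℕ; suc; _≤_)
open import Data.Fin using (Fin; toℕ)
open import Data.Vec using (Vec; lookup)
open import Data.Product using (_×_)
open import Data.Sum using (_⊎_)
open import Relation.Binary.PropositionalEquality using (_≡_; _≢_)

open import Data.Bool using (true; false; not; T; if_then_else_)
open import Data.Bool.Properties using (∧-conicalˡ; ∧-conicalʳ)
open import Data.Empty using (⊥; ⊥-elim)
open import Data.Fin using (zero; inject₁; lower₁; _≟_) renaming (suc to fsuc)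
open import Data.Fin.Properties using (toℕ-injective; toℕ<n; inject₁-lower₁)
open import Data.Maybe using (just)
open import Data.Maybe.Properties using (just-injective)
open import Data.Nat using (_<_; _+_; _∸_; _<ᵇ_)
open import Data.Nat.Properties
  using ( <ᵇ⇒<; <⇒<ᵇ; ≮⇒≥; ≰⇒>; <-irrefl; <-asym; <⇒≤; ≤-trans; ≤-<-trans
        ; <-≤-trans; ≤∧≢⇒<; m≤m+n; m∸n≤m; m∸n+n≡m; +-assoc; +-comm
        ; +-cancelˡ-≡; +-cancelˡ-<; +-cancelʳ-<; +-monoˡ-<; +-monoʳ-<
        ; +-mono-<-≤ )
  renaming (_≟_ to _ℕ≟_)
open import Data.Product using (_,_; proj₁; proj₂)
open import Data.Sum using (inj₁; inj₂)
open import Data.Unit using (tt)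
open import Relation.Nullary using (¬_; yes; no)
open import Relation.Binary.PropositionalEquality
  using (refl; sym; trans; cong; subst; subst₂; module ≡-Reasoning)

smaller-summand : ∀ {a b x u} → a + x ≡ b + u → a < b → u < x
smaller-summand eq a<b = ≰⇒> (λ x≤u → <-irrefl eq (+-mono-<-≤ a<b x≤u))

direct-short : ∀ d u {v} → d + u ≡ v → d ≤ v
direct-short d u eq = subst (d ≤_) eq (m≤m+n d u)

wrapped-long : ∀ {n} d u {v} → u < n → d + u ≡ n + v → v < d
wrapped-long {n} d u {v} u<n eq = +-cancelʳ-< u v d
  (subst (v + u <_) (trans (+-comm v n) (sym eq)) (+-monoʳ-< v u<n))

module Arcs {n : ℕ} where

  -- The clockwise arc from u to v either stays below n (u < v) or wraps
  -- around once (v ≤ u); in both cases its length is pinned down by an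
  -- equation, which is all the later arguments use about dist.
  data Arc (u v : Fin n) : Set where
    direct  : toℕ u < toℕ v → dist u v + toℕ u ≡ toℕ v → Arc u v
    wrapped : toℕ v ≤ toℕ u → dist u v + toℕ u ≡ n + toℕ v → Arc u v

  dist-by : ∀ u v {b} → (toℕ u <ᵇ toℕ v) ≡ b →
            dist u v ≡ (if b then toℕ v ∸ toℕ u else n ∸ (toℕ u ∸ toℕ v))
  dist-by u v = cong (λ b → if b then toℕ v ∸ toℕ u else n ∸ (toℕ u ∸ toℕ v))

  arc : (u v : Fin n) → Arc u v
  arc u v with toℕ u <ᵇ toℕ v in lt
  ... | true  = direct u<v (trans (cong (_+ toℕ u) (dist-by u v lt)) (m∸n+n≡m (<⇒≤ u<v)))
    where
      u<v : toℕ u < toℕ v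
      u<v = <ᵇ⇒< (toℕ u) (toℕ v) (subst T (sym lt) tt)
  ... | false = wrapped v≤u (trans (cong (_+ toℕ u) (dist-by u v lt)) wrap-length)
    where
      v≤u : toℕ v ≤ toℕ u
      v≤u = ≮⇒≥ (λ u<v → subst T lt (<⇒<ᵇ u<v))
      u∸v≤n : toℕ u ∸ toℕ v ≤ n
      u∸v≤n = ≤-trans (m∸n≤m (toℕ u) (toℕ v)) (<⇒≤ (toℕ<n u))
      open ≡-Reasoning
      wrap-length : n ∸ (toℕ u ∸ toℕ v) + toℕ u ≡ n + toℕ v
      wrap-length = begin
        n ∸ (toℕ u ∸ toℕ v) + toℕ u
          ≡⟨ cong (n ∸ (toℕ u ∸ toℕ v) +_) (sym (m∸n+n≡m v≤u)) ⟩
        n ∸ (toℕ u ∸ toℕ v) + (toℕ u ∸ toℕ v + toℕ v)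
          ≡⟨ sym (+-assoc (n ∸ (toℕ u ∸ toℕ v)) (toℕ u ∸ toℕ v) (toℕ v)) ⟩
        n ∸ (toℕ u ∸ toℕ v) + (toℕ u ∸ toℕ v) + toℕ v
          ≡⟨ cong (_+ toℕ v) (m∸n+n≡m u∸v≤n) ⟩
        n + toℕ v ∎

  dist-injectiveʳ : ∀ u {v v'} → dist u v ≡ dist u v' → v ≡ v'
  dist-injectiveʳ u {v} {v'} eq with arc u v | arc u v'
  ... | direct _ e | direct _ e' =
    toℕ-injective (trans (sym e) (trans (cong (_+ toℕ u) eq) e'))
  ... | wrapped _ e | wrapped _ e' =
    toℕ-injective (+-cancelˡ-≡ n _ _ (trans (sym e) (trans (cong (_+ toℕ u) eq) e')))
  ... | direct _ e | wrapped _ e' =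
    ⊥-elim (<-irrefl (trans (sym e) (trans (cong (_+ toℕ u) eq) e'))
                     (<-≤-trans (toℕ<n v) (m≤m+n n (toℕ v'))))
  ... | wrapped _ e | direct _ e' =
    ⊥-elim (<-irrefl (trans (sym e') (trans (cong (_+ toℕ u) (sym eq)) e))
                     (<-≤-trans (toℕ<n v') (m≤m+n n (toℕ v))))

  dist-injectiveˡ : ∀ {u u'} v → dist u v ≡ dist u' v → u ≡ u'
  dist-injectiveˡ {u} {u'} v eq with arc u v | arc u' v
  ... | direct _ e | direct _ e' =
    toℕ-injective (+-cancelˡ-≡ (dist u v) _ _
                     (trans e (trans (sym e') (cong (_+ toℕ u') (sym eq)))))
  ... | wrapped _ e | wrapped _ e' =
    toℕ-injective (+-cancelˡ-≡ (dist u v) _ _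
                     (trans e (trans (sym e') (cong (_+ toℕ u') (sym eq)))))
  ... | direct _ e | wrapped _ e' =
    ⊥-elim (<-irrefl refl (≤-<-trans (direct-short _ _ e)
                             (subst (toℕ v <_) (sym eq) (wrapped-long _ _ (toℕ<n u') e'))))
  ... | wrapped _ e | direct _ e' =
    ⊥-elim (<-irrefl refl (≤-<-trans (direct-short _ _ e')
                             (subst (toℕ v <_) eq (wrapped-long _ _ (toℕ<n u) e))))

  shorter-arc-from : ∀ u {v w} → v ≢ u → dist u w < dist u v → Clockwise u w v
  shorter-arc-from u {v} {w} v≢u shorter with arc u v | arc u w
  ... | direct _ e | direct u<w e' =
    inj₁ (u<w , subst₂ _<_ e' e (+-monoˡ-< (toℕ u) shorter))
  ... | direct _ e | wrapped _ e' =
    ⊥-elim (<-asym (+-monoˡ-< (toℕ u) shorter)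
             (subst₂ _<_ (sym e) (sym e') (<-≤-trans (toℕ<n v) (m≤m+n n (toℕ w)))))
  ... | wrapped v≤u _ | direct u<w _ = inj₂ (inj₂ (v<u , u<w))
    where
      v<u : toℕ v < toℕ u
      v<u = ≤∧≢⇒< v≤u (λ eq → v≢u (toℕ-injective eq))
  ... | wrapped v≤u e | wrapped _ e' = inj₂ (inj₁ (w<v , v<u))
    where
      v<u : toℕ v < toℕ u
      v<u = ≤∧≢⇒< v≤u (λ eq → v≢u (toℕ-injective eq))
      w<v : toℕ w < toℕ v
      w<v = +-cancelˡ-< n (toℕ w) (toℕ v) (subst₂ _<_ e' e (+-monoˡ-< (toℕ u) shorter))

  shorter-arc-into : ∀ {u x} y → u ≢ y → dist x y < dist u y → Clockwise u x y
  shorter-arc-into {u} {x} y u≢y shorter with arc u y | arc x y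
  ... | direct _ e | direct x<y e' = inj₁ (smaller-summand (trans e' (sym e)) shorter , x<y)
  ... | direct _ e | wrapped _ e' =
    ⊥-elim (<-asym shorter (≤-<-trans (direct-short _ _ e) (wrapped-long _ _ (toℕ<n x) e')))
  ... | wrapped y≤u _ | direct x<y _ = inj₂ (inj₁ (x<y , y<u))
    where
      y<u : toℕ y < toℕ u
      y<u = ≤∧≢⇒< y≤u (λ eq → u≢y (toℕ-injective (sym eq)))
  ... | wrapped y≤u e | wrapped _ e' =
    inj₂ (inj₂ (y<u , smaller-summand (trans e' (sym e)) shorter))
    where
      y<u : toℕ y < toℕ u
      y<u = ≤∧≢⇒< y≤u (λ eq → u≢y (toℕ-injective (sym eq)))

open Arcs

module _ {n : ℕ} (G : Digraph n) where

  nonEdge⇒¬edge : ∀ {u v} → nonEdge? G u v ≡ true → G u v ≢ true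
  nonEdge⇒¬edge {u} {v} ne e with () ←
    trans (sym (cong not e)) (∧-conicalˡ _ _ (∧-conicalʳ (distinct? u v) _ ne))

  edge⇒distinct : Loopless G → ∀ {u v} → G u v ≡ true → v ≢ u
  edge⇒distinct loopless {u} e refl with () ← trans (sym e) (loopless u)

  module ExtremeUniqueness (admissible : Admissible G) (gap : BetaGtAlpha G) where

    loopless : Loopless G
    loopless = proj₁ admissible

    interval : CircularInterval G
    interval = proj₂ (proj₂ admissible)

    non-edge-shorter : ∀ {u v x y} → LongestEdge G u v → ShortestNonEdge G x y →
                       dist x y < dist u v
    non-edge-shorter (_ , β≡) (_ , α≡) =
      subst₂ _<_ (just-injective (trans (sym α≡a) α≡)) (sym β≡) a<β
      where
        α≡a : α G ≡ just (proj₁ gap)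
        α≡a = proj₁ (proj₂ gap)
        a<β : proj₁ gap < β G
        a<β = proj₂ (proj₂ gap)

    -- The shortest non-edge uw would lie inside the longest edge uv.
    no-shared-tail : ∀ {u v w} → LongestEdge G u v → ShortestNonEdge G u w → ⊥
    no-shared-tail {u} {v} {w} le@(e , _) sne@(ne , _) =
      nonEdge⇒¬edge {u} {w} ne (proj₁ (interval u w v inside e))
      where
        inside : Clockwise u w v
        inside = shorter-arc-from u (edge⇒distinct loopless e)
                                    (non-edge-shorter {u} {v} {u} {w} le sne)

    -- The shortest non-edge xy would lie inside the longest edge uy.
    no-shared-head : ∀ {u x y} → LongestEdge G u y → ShortestNonEdge G x y → ⊥
    no-shared-head {u} {x} {y} le@(e , _) sne@(ne , _) =
      nonEdge⇒¬edge {x} {y} ne (proj₂ (interval u x y inside e))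
      where
        inside : Clockwise u x y
        inside = shorter-arc-into y (λ u≡y → edge⇒distinct loopless e (sym u≡y))
                                    (non-edge-shorter {u} {y} {x} {y} le sne)

    extreme-tail-unique : ∀ {u v w} → Extreme G u v → Extreme G u w → v ≡ w
    extreme-tail-unique {u} (inj₁ (_ , d)) (inj₁ (_ , d')) =
      dist-injectiveʳ u (trans d (sym d'))
    extreme-tail-unique {u} (inj₂ (_ , d)) (inj₂ (_ , d')) =
      dist-injectiveʳ u (just-injective (trans (sym d) d'))
    extreme-tail-unique (inj₁ le) (inj₂ sne) = ⊥-elim (no-shared-tail le sne)
    extreme-tail-unique (inj₂ sne) (inj₁ le) = ⊥-elim (no-shared-tail le sne)

    extreme-head-unique : ∀ {u x y} → Extreme G u y → Extreme G x y → u ≡ x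
    extreme-head-unique {y = y} (inj₁ (_ , d)) (inj₁ (_ , d')) =
      dist-injectiveˡ y (trans d (sym d'))
    extreme-head-unique {y = y} (inj₂ (_ , d)) (inj₂ (_ , d')) =
      dist-injectiveˡ y (just-injective (trans (sym d) d'))
    extreme-head-unique (inj₁ le) (inj₂ sne) = ⊥-elim (no-shared-head le sne)
    extreme-head-unique (inj₂ sne) (inj₁ le) = ⊥-elim (no-shared-head le sne)

module AlternatingSequence {n : ℕ} (G : Digraph n) (admissible : Admissible G)
                           (gap : BetaGtAlpha G) {k : ℕ} (vs : Vec (Fin n) (suc k))
                           (alternating : Alternating G vs) where

  open ExtremeUniqueness G admissible gap

  extreme : ∀ i → Extreme G (src G vs i) (tgt G vs i)
  extreme = proj₁ alternating

  distinct : ∀ i j → i ≢ j → ¬ (src G vs i ≡ src G vs j × tgt G vs i ≡ tgt G vs j)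
  distinct = proj₁ (proj₂ alternating)

  tail-injective : ∀ i j → src G vs i ≡ src G vs j → i ≡ j
  tail-injective i j same with i ≟ j
  ... | yes i≡j = i≡j
  ... | no  i≢j = ⊥-elim (distinct i j i≢j (same , extreme-tail-unique fᵢ (extreme j)))
    where
      fᵢ : Extreme G (src G vs j) (tgt G vs i)
      fᵢ = subst (λ s → Extreme G s (tgt G vs i)) same (extreme i)

  head-injective : ∀ i j → tgt G vs i ≡ tgt G vs j → i ≡ j
  head-injective i j same with i ≟ j
  ... | yes i≡j = i≡j
  ... | no  i≢j = ⊥-elim (distinct i j i≢j (extreme-head-unique fᵢ (extreme j) , same))
    where
      fᵢ : Extreme G (src G vs i) (tgt G vs j)
      fᵢ = subst (Extreme G (src G vs i)) same (extreme i)

  first-tail : (r : Fin k) → lookup vs zero ≡ src G vs r → inject₁ r ≡ zero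
  first-tail zero     _    = refl
  first-tail (fsuc r) same with () ← tail-injective zero (fsuc r) same

  -- The first vertex can reappear only as the last one: any other position
  -- j is the tail of the pair f_j, which would then be the first pair.
  start-recurs-only-at-end : ∀ j → lookup vs zero ≡ lookup vs j →
                             j ≡ zero ⊎ toℕ j ≡ k
  start-recurs-only-at-end j same with k ℕ≟ toℕ j
  ... | yes k≡j = inj₂ (sym k≡j)
  ... | no  k≢j =
    inj₁ (trans (sym j≡r) (first-tail r (trans same (cong (lookup vs) (sym j≡r)))))
    where
      r : Fin k
      r = lower₁ j k≢j
      j≡r : inject₁ r ≡ j
      j≡r = inject₁-lower₁ j k≢j

lemma3p13 : (n : ℕ) → 4 ≤ n → (G : Digraph n) → Optimal G → BetaGtAlpha G →
            (k : ℕ) (vs : Vec (Fin n) (suc k)) → Augmenting G vs →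
            ∀ i j → i ≢ j → lookup vs i ≡ lookup vs j →
            (toℕ i ≡ 0 × toℕ j ≡ k) ⊎ (toℕ j ≡ 0 × toℕ i ≡ k)
lemma3p13 n _ G (admissible , _) gap k vs (alternating , _) = repeat
  where
    open AlternatingSequence G admissible gap vs alternating

    -- A repeat involving v_1 must be at v_{k+1}; a repeat of two later
    -- vertices would give two pairs with the same head.
    repeat : ∀ i j → i ≢ j → lookup vs i ≡ lookup vs j →
             (toℕ i ≡ 0 × toℕ j ≡ k) ⊎ (toℕ j ≡ 0 × toℕ i ≡ k)
    repeat zero j i≢j same with start-recurs-only-at-end j same
    ... | inj₁ j≡0 = ⊥-elim (i≢j (sym j≡0))
    ... | inj₂ j≡k = inj₁ (refl , j≡k)
    repeat (fsuc p) zero _ same with start-recurs-only-at-end (fsuc p) (sym same)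
    ... | inj₁ ()
    ... | inj₂ i≡k = inj₂ (refl , i≡k)
    repeat (fsuc p) (fsuc q) i≢j same = ⊥-elim (i≢j (cong fsuc (head-injective p q same)))
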